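{- Let $N,i,j$ be non-negative integers with $N\ge i$ and $N\ge j$. Then $$P_{1,2N+1}(i,j,q)=P_{1,2N}(i,j,q)+\chi(i\ge 1)\,q^{3N+2}P_{2,2N}(i-1,j,q),$$ $$P_{1,2N+2}(i,j,q)=P_{1,2N+1}(i,j,q)+q^{3(N+1)}P_{2,2N+1}(i,j,q),$$ $$P_{2,2N+1}(i,j,q)=P_{2,2N}(i,j,q)+\chi(j\ge 1)\,q^{3N+1}P_{1,2N}(i,j-1,q),$$ $$P_{2,2N+2}(i,j,q)=P_{2,2N+1}(i,j,q)+q^{3(N+1)}P_{1,2N+1}(i,j,q),$$ where $\chi(\text{statement})$ equals $1$ if the statement is true and $0$ otherwise.
   Context: A partition is a finite non-increasing sequence $\pi=(\pi_1,\pi_2,\dots)$ of positive integers (the empty sequence allowed); $\pi_k$ is the part of index $k$. For real $x$, $\lceil x\rceil$ is the least integer $\ge x$ and $\{\{x\}\}=x-\lfloor x\rfloor$. For $m\in\{1,2\}$ and non-negative integers $M,i,j$, $P_{m,M}(i,j,q)=\sum_\pi q^{\pi_1+\pi_2+\cdots}$, the sum over all partitions $\pi$ such that: (i) $\pi_{2l+r}\not\equiv 3-m+(-1)^m r\pmod 3$ for $r\in\{0,1\}$ and all $l\ge0$ with $2l+r\ge1$; (ii) $\pi_{2l+r}-\pi_{2l+1+r}>\lfloor m/2\rfloor+(-1)^{m-1}r$ for $r\in\{0,1\}$ and all $l\ge 0$ with $2l+r\ge 1$ (whenever both parts exist); (iii) $\pi_1\le 3\lceil M/2\rceil-2m\{\{M/2\}\}$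 (i.e. $\pi_1\le 3N$ when $M=2N$, and $\pi_1\le 3N+3-m$ when $M=2N+1$); (iv) exactly $i$ parts are congruent to $2$ modulo $3$; (v) exactly $j$ parts are congruent to $1$ modulo $3$. -}

module Defs where

open import Data.Nat using (ℕ; zero; suc; _+_; _*_; _∸_; _⊓_; _<ᵇ_; _≤ᵇ_; _≡ᵇ_; _%_; _/_)
open import Data.Bool using (Bool; true; false; _∧_; not; if_then_else_)
open import Data.List using (List; []; _∷_; map; concatMap; applyUpTo; length; filterᵇ)
open import Data.Nat.ListAction using (sum)

-- A partition is a non-increasing list of positive integers (π₁ ≥ π₂ ≥ …).
-- bnd fuel k n lists all partitions of n with all parts ≤ k
-- (fuel ≥ n suffices since every step removes a part ≥ 1).

bnd : ℕ → ℕ → ℕ → List (List ℕ)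
bnd _        k zero    = [] ∷ []
bnd zero     k (suc n) = []
bnd (suc f)  k (suc n) =
  concatMap (λ p → map (p ∷_) (bnd f p (suc n ∸ p)))
            (applyUpTo suc (k ⊓ suc n))

partitionsOf : ℕ → List (List ℕ)
partitionsOf n = bnd n n n

-- sanity re-check that a list is a partition of n (redundant with the enumeration)
nonIncPos : List ℕ → Bool
nonIncPos []              = true
nonIncPos (a ∷ [])        = 1 ≤ᵇ a
nonIncPos (a ∷ b ∷ rest)  = (b ≤ᵇ a) ∧ nonIncPos (b ∷ rest)

isPartitionOf : ℕ → List ℕ → Bool
isPartitionOf n π = nonIncPos π ∧ (sum π ≡ᵇ n)

-- The conditions (i)–(v), for m ∈ {1,2}; parts are indexed from 1 and
-- index k = 2l + r with r = k mod 2.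

-- forbidden residue 3 - m + (-1)^m r  (≥ 1 for m ∈ {1,2}, r ∈ {0,1})
forbRes : ℕ → ℕ → ℕ
forbRes m r = if (m % 2 ≡ᵇ 0) then (3 ∸ m) + r else (3 ∸ m) ∸ r

-- gap ⌊m/2⌋ + (-1)^(m-1) r  (≥ 0 for m ∈ {1,2})
gap : ℕ → ℕ → ℕ
gap m r = if (m % 2 ≡ᵇ 1) then (m / 2) + r else (m / 2) ∸ r

condI : ℕ → ℕ → List ℕ → Bool
condI m k []      = true
condI m k (a ∷ π) = not (a % 3 ≡ᵇ forbRes m (k % 2) % 3) ∧ condI m (suc k) π

condII : ℕ → ℕ → List ℕ → Bool
condII m k []            = true
condII m k (a ∷ [])      = true
condII m k (a ∷ b ∷ π)   = ((b + gap m (k % 2)) <ᵇ a) ∧ condII m (suc k) (b ∷ π)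

-- bound in (iii): 3N when M = 2N, 3N + 3 - m when M = 2N + 1
bound : ℕ → ℕ → ℕ
bound m M = if (M % 2 ≡ᵇ 0) then 3 * (M / 2) else 3 * (M / 2) + 3 ∸ m

condIII : ℕ → ℕ → List ℕ → Bool
condIII m M []      = true
condIII m M (a ∷ π) = a ≤ᵇ bound m M

countRes : ℕ → List ℕ → ℕ
countRes c π = length (filterᵇ (λ a → a % 3 ≡ᵇ c) π)

valid : ℕ → ℕ → ℕ → ℕ → ℕ → List ℕ → Bool
valid m M i j n π =
  isPartitionOf n π ∧ condI m 1 π ∧ condII m 1 π ∧ condIII m M π
  ∧ (countRes 2 π ≡ᵇ i) ∧ (countRes 1 π ≡ᵇ j)

-- coefficient of q^n in P_{m,M}(i,j,q)
P : ℕ → ℕ → ℕ → ℕ → ℕ → ℕ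
P m M i j n = length (filterᵇ (valid m M i j n) (partitionsOf n))

-- coefficient of q^n in q^s · F(q), where f gives the coefficients of F
shiftCoeff : ℕ → (ℕ → ℕ) → ℕ → ℕ
shiftCoeff s f n = if s ≤ᵇ n then f (n ∸ s) else 0

χ : Bool → ℕ
χ true  = 1
χ false = 0

module Submission where

-- Write P_m(b) for the number of partitions of n obeying
-- conditions (i), (ii), (iv), (v) whose largest part is at most b, so that
-- P_{m,M} = P_m(bound m M).  Raising the bound from b to b + 1 adds exactly
-- the admissible partitions whose largest part equals b + 1 (Pb-raise).
-- If b + 1 lies in the residue class forbidden for the first part, nothing
-- is added; otherwise removing the largest part s = b + 1 is a bijection
-- onto the partitions of n - s counted by P_{3-m}(b'), where b' is s minus
-- the gap prescribed by (ii) between the first two parts, and where the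
-- residue counts (iv), (v) drop by one in the class of s (headed-tail):
-- after the first part, the roles of odd and even indices, hence of m = 1
-- and m = 2, are swapped.  Each identity of lemma1 is one or two such steps.

open import Defs
open import Data.Nat using (ℕ; _+_; _*_; _∸_; _≤_; _≤ᵇ_)
open import Data.Product using (_×_)
open import Relation.Binary.PropositionalEquality using (_≡_)

open import Data.Nat using (zero; suc; _<_; _⊓_; _<ᵇ_; _≡ᵇ_; _%_; _/_; _≟_; _≤?_; _<?_; z≤n; s≤s)
open import Data.Nat.Properties
open import Data.Nat.DivMod using (%-congˡ; /-congˡ; [m+kn]%n≡m%n; m*n%n≡0; m*n/n≡m; +-distrib-/-∣ˡ)
open import Data.Nat.Divisibility using (m∣m*n)
open import Data.Nat.ListAction using (sum)
open import Data.Bool using (Bool; true; false; _∧_; not; if_then_else_)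
open import Data.Bool.Properties using (∧-zeroʳ; T-≡)
open import Data.List using (List; []; _∷_; _++_; map; concatMap; applyUpTo; length; filterᵇ)
open import Data.List.Properties using (filter-++; length-++)
open import Data.Product using (_,_)
open import Function using (_∘_; mk⇔; Equivalence)
open import Relation.Nullary.Decidable using (T?; dec-true; dec-false; does-⇔)
open import Relation.Binary.PropositionalEquality using (refl; sym; trans; cong; cong₂; subst; _≢_; module ≡-Reasoning)
open import Algebra.Properties.CommutativeSemigroup +-commutativeSemigroup using (xy∙z≈xz∙y)

open ≡-Reasoning

≤ᵇ-sound : ∀ {m n} → (m ≤ᵇ n) ≡ true → m ≤ n
≤ᵇ-sound {m} {n} e = ≤ᵇ⇒≤ m n (Equivalence.from T-≡ e)

≤ᵇ-suc-off-boundary : ∀ x b → x ≢ b → (suc x ≤ᵇ suc b) ≡ (suc x ≤ᵇ b)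
≤ᵇ-suc-off-boundary x b x≢b = does-⇔ (mk⇔ to m≤n⇒m≤1+n) (suc x ≤? suc b) (suc x ≤? b)
  where
  to : suc x ≤ suc b → suc x ≤ b
  to (s≤s x≤b) = ≤∧≢⇒< x≤b x≢b

≡ᵇ-cancelˡ : ∀ d x y → (d + x ≡ᵇ d + y) ≡ (x ≡ᵇ y)
≡ᵇ-cancelˡ zero    x y = refl
≡ᵇ-cancelˡ (suc d) x y = ≡ᵇ-cancelˡ d x y

sum-condition : ∀ s n x → s ≤ n → (s + x ≡ᵇ n) ≡ (x ≡ᵇ n ∸ s)
sum-condition s n x s≤n = does-⇔ (mk⇔ to from) (s + x ≟ n) (x ≟ n ∸ s)
  where
  to : s + x ≡ n → x ≡ n ∸ s
  to e = trans (sym (m+n∸m≡n s x)) (cong (_∸ s) e)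
  from : x ≡ n ∸ s → s + x ≡ n
  from e = trans (cong (s +_) e) (m+[n∸m]≡n s≤n)

gap-condition : ∀ b g b₂ → (b + g <ᵇ suc (g + b₂)) ≡ (b ≤ᵇ b₂)
gap-condition b g b₂ = does-⇔ (mk⇔ to from) (b + g <? suc (g + b₂)) (b ≤? b₂)
  where
  to : b + g < suc (g + b₂) → b ≤ b₂
  to (s≤s le) = +-cancelˡ-≤ g b b₂ (subst (_≤ g + b₂) (+-comm b g) le)
  from : b ≤ b₂ → b + g < suc (g + b₂)
  from le = s≤s (subst (_≤ g + b₂) (+-comm g b) (+-monoʳ-≤ g le))

count : (List ℕ → Bool) → List (List ℕ) → ℕ
count q L = length (filterᵇ q L)

count-++ : ∀ q xs ys → count q (xs ++ ys) ≡ count q xs + count q ys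
count-++ q xs ys = trans (cong length (filter-++ (T? ∘ q) xs ys)) (length-++ (filterᵇ q xs))

count-map-cons : ∀ q p L → count q (map (p ∷_) L) ≡ count (λ r → q (p ∷ r)) L
count-map-cons q p []      = refl
count-map-cons q p (x ∷ L) with q (p ∷ x)
... | true  = cong suc (count-map-cons q p L)
... | false = count-map-cons q p L

count-cong : ∀ q q' L → (∀ r → q r ≡ q' r) → count q L ≡ count q' L
count-cong q q' []      h = refl
count-cong q q' (x ∷ L) h with q x | q' x | h x
... | true  | .true  | refl = cong suc (count-cong q q' L h)
... | false | .false | refl = count-cong q q' L h

count-empty : ∀ q q' → q [] ≡ q' [] → count q ([] ∷ []) ≡ count q' ([] ∷ [])
count-empty q q' e with q [] | q' [] | e
... | true  | .true  | refl = refl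
... | false | .false | refl = refl

count-none : ∀ q L → (∀ r → q r ≡ false) → count q L ≡ 0
count-none q []      h = refl
count-none q (x ∷ L) h with q x | h x
... | .false | refl = count-none q L h

sumBelow : ℕ → (ℕ → ℕ) → ℕ
sumBelow zero    t = 0
sumBelow (suc a) t = t 0 + sumBelow a (λ x → t (suc x))

sumBelow-cong : ∀ a t u → (∀ x → t x ≡ u x) → sumBelow a t ≡ sumBelow a u
sumBelow-cong zero    t u h = refl
sumBelow-cong (suc a) t u h = cong₂ _+_ (h 0) (sumBelow-cong a _ _ (λ x → h (suc x)))

sumBelow-zero : ∀ a t → (∀ x → t x ≡ 0) → sumBelow a t ≡ 0
sumBelow-zero zero    t h = refl
sumBelow-zero (suc a) t h = cong₂ _+_ (h 0) (sumBelow-zero a _ (λ x → h (suc x)))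

sumBelow-truncate : ∀ k a t → (∀ x → k ≤ x → t x ≡ 0) → sumBelow (k ⊓ a) t ≡ sumBelow a t
sumBelow-truncate zero    a       t h = sym (sumBelow-zero a t (λ x → h x z≤n))
sumBelow-truncate (suc k) zero    t h = refl
sumBelow-truncate (suc k) (suc a) t h =
  cong (t 0 +_) (sumBelow-truncate k a _ (λ x k≤x → h (suc x) (s≤s k≤x)))

sumBelow-bump : ∀ a c X t t' → (∀ x → x ≢ c → t' x ≡ t x) → t' c ≡ t c + X →
  sumBelow a t' ≡ sumBelow a t + (if c <ᵇ a then X else 0)
sumBelow-bump zero    c       X t t' same bumped = refl
sumBelow-bump (suc a) zero    X t t' same bumped = begin
  t' 0 + sumBelow a (λ x → t' (suc x))
    ≡⟨ cong₂ _+_ bumped (sumBelow-cong a _ _ (λ x → same (suc x) (λ ()))) ⟩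
  t 0 + X + sumBelow a (λ x → t (suc x))
    ≡⟨ xy∙z≈xz∙y (t 0) X _ ⟩
  t 0 + sumBelow a (λ x → t (suc x)) + X ∎
sumBelow-bump (suc a) (suc c) X t t' same bumped = begin
  t' 0 + sumBelow a (λ x → t' (suc x))
    ≡⟨ cong₂ _+_ (same 0 (λ ()))
         (sumBelow-bump a c X _ _ (λ x x≢c → same (suc x) (x≢c ∘ suc-injective)) bumped) ⟩
  t 0 + (sumBelow a (λ x → t (suc x)) + (if c <ᵇ a then X else 0))
    ≡⟨ sym (+-assoc (t 0) _ _) ⟩
  t 0 + sumBelow a (λ x → t (suc x)) + (if c <ᵇ a then X else 0) ∎

count-concatMap : ∀ q (F : ℕ → List (List ℕ)) h a →
  count q (concatMap F (applyUpTo h a)) ≡ sumBelow a (λ x → count q (F (h x)))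
count-concatMap q F h zero    = refl
count-concatMap q F h (suc a) =
  trans (count-++ q (F (h 0)) _) (cong (count q (F (h 0)) +_) (count-concatMap q F (h ∘ suc) a))

-- The enumeration of partitions, decomposed by largest part

bounded : ℕ → ℕ → List (List ℕ)
bounded k r = bnd r k r

concatMap-applyUpTo-cong : ∀ (F G : ℕ → List (List ℕ)) h a → (∀ x → F (h x) ≡ G (h x)) →
  concatMap F (applyUpTo h a) ≡ concatMap G (applyUpTo h a)
concatMap-applyUpTo-cong F G h zero    e = refl
concatMap-applyUpTo-cong F G h (suc a) e =
  cong₂ _++_ (e 0) (concatMap-applyUpTo-cong F G (h ∘ suc) a (λ x → e (suc x)))

fuel-irrelevant : ∀ f f' k r → r ≤ f → r ≤ f' → bnd f k r ≡ bnd f' k r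
fuel-irrelevant f       f'       k zero    _         _          = refl
fuel-irrelevant (suc f) (suc f') k (suc r) (s≤s r≤f) (s≤s r≤f') =
  concatMap-applyUpTo-cong _ _ suc (k ⊓ suc r) (λ x → cong (map (suc x ∷_))
    (fuel-irrelevant f f' (suc x) (r ∸ x) (≤-trans (m∸n≤m r x) r≤f) (≤-trans (m∸n≤m r x) r≤f')))

largest : (List ℕ → Bool) → ℕ → ℕ → ℕ
largest q N p = count (λ r → q (p ∷ r)) (bounded p (N ∸ p))

count-by-largest : ∀ q f k r → r ≤ f →
  count q (bnd (suc f) k (suc r)) ≡ sumBelow (k ⊓ suc r) (λ x → largest q (suc r) (suc x))
count-by-largest q f k r r≤f =
  trans (count-concatMap q (λ p → map (p ∷_) (bnd f p (suc r ∸ p))) suc (k ⊓ suc r))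
        (sumBelow-cong (k ⊓ suc r) _ _ λ x →
          trans (count-map-cons q (suc x) (bnd f (suc x) (r ∸ x)))
                (cong (count (λ t → q (suc x ∷ t)))
                      (fuel-irrelevant f (r ∸ x) (suc x) (r ∸ x) (≤-trans (m∸n≤m r x) r≤f) ≤-refl)))

count-partitions : ∀ q n →
  count q (partitionsOf (suc n)) ≡ sumBelow (suc n) (λ x → largest q (suc n) (suc x))
count-partitions q n =
  trans (count-by-largest q n (suc n) n ≤-refl)
        (cong (λ a → sumBelow a (λ x → largest q (suc n) (suc x))) (⊓-idem (suc n)))

count-bounded : ∀ q k r → (∀ p t → k < p → q (p ∷ t) ≡ false) →
  count q (bounded k r) ≡ count q (partitionsOf r)
count-bounded q k zero    rejects = refl
count-bounded q k (suc r) rejects = begin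
  count q (bnd (suc r) k (suc r))
    ≡⟨ count-by-largest q r k r ≤-refl ⟩
  sumBelow (k ⊓ suc r) (λ x → largest q (suc r) (suc x))
    ≡⟨ sumBelow-truncate k (suc r) _ (λ x k≤x →
         count-none _ (bounded (suc x) (r ∸ x)) (λ t → rejects (suc x) t (s≤s k≤x))) ⟩
  sumBelow (suc r) (λ x → largest q (suc r) (suc x))
    ≡⟨ sym (count-partitions q r) ⟩
  count q (partitionsOf (suc r)) ∎

count-head-change : ∀ q q' c n → q' [] ≡ q [] →
  (∀ x → x ≢ c → ∀ t → q' (suc x ∷ t) ≡ q (suc x ∷ t)) →
  (∀ t → q (suc c ∷ t) ≡ false) →
  count q' (partitionsOf n) ≡ count q (partitionsOf n) + (if suc c ≤ᵇ n then largest q' n (suc c) else 0)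
count-head-change q q' c zero    empty agree rejects =
  trans (count-empty q' q empty) (sym (+-identityʳ _))
count-head-change q q' c (suc n) empty agree rejects = begin
  count q' (partitionsOf (suc n))
    ≡⟨ count-partitions q' n ⟩
  sumBelow (suc n) (λ x → largest q' (suc n) (suc x))
    ≡⟨ sumBelow-bump (suc n) c _ _ _
         (λ x x≢c → count-cong _ _ (bounded (suc x) (n ∸ x)) (agree x x≢c))
         (cong (_+ largest q' (suc n) (suc c))
               (sym (count-none _ (bounded (suc c) (n ∸ c)) rejects))) ⟩
  sumBelow (suc n) (λ x → largest q (suc n) (suc x)) + _
    ≡⟨ cong (_+ _) (sym (count-partitions q n)) ⟩
  count q (partitionsOf (suc n)) + _ ∎

largestAtMost : ℕ → List ℕ → Bool
largestAtMost b []      = true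
largestAtMost b (p ∷ _) = p ≤ᵇ b

validAt : ℕ → ℕ → ℕ → ℕ → ℕ → List ℕ → Bool
validAt m b i j n π =
  isPartitionOf n π ∧ condI m 1 π ∧ condII m 1 π ∧ largestAtMost b π
  ∧ (countRes 2 π ≡ᵇ i) ∧ (countRes 1 π ≡ᵇ j)

Pb : ℕ → ℕ → ℕ → ℕ → ℕ → ℕ
Pb m b i j n = count (validAt m b i j n) (partitionsOf n)

P-as-Pb : ∀ m M b i j n → bound m M ≡ b → P m M i j n ≡ Pb m b i j n
P-as-Pb m M b i j n refl = count-cong _ _ (partitionsOf n) valid-as-validAt
  where
  valid-as-validAt : ∀ π → valid m M i j n π ≡ validAt m (bound m M) i j n π
  valid-as-validAt []      = refl
  valid-as-validAt (_ ∷ _) = refl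

forbiddenResidue : ℕ → ℕ → Bool
forbiddenResidue m k = k ≡ᵇ forbRes m 1 % 3

validAt-bound : ∀ m b b' i j n p t → (p ≤ᵇ b') ≡ (p ≤ᵇ b) →
  validAt m b' i j n (p ∷ t) ≡ validAt m b i j n (p ∷ t)
validAt-bound m b b' i j n p t e =
  cong (λ z → isPartitionOf n (p ∷ t) ∧ condI m 1 (p ∷ t) ∧ condII m 1 (p ∷ t)
                ∧ z ∧ (countRes 2 (p ∷ t) ≡ᵇ i) ∧ (countRes 1 (p ∷ t) ≡ᵇ j)) e

validAt-rejects : ∀ m b i j n π →
  (largestAtMost b π ∧ (countRes 2 π ≡ᵇ i) ∧ (countRes 1 π ≡ᵇ j)) ≡ false →
  validAt m b i j n π ≡ false
validAt-rejects m b i j n π e = begin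
  validAt m b i j n π
    ≡⟨ cong (λ z → A ∧ I ∧ II ∧ z) e ⟩
  A ∧ I ∧ (II ∧ false)
    ≡⟨ cong (λ z → A ∧ (I ∧ z)) (∧-zeroʳ II) ⟩
  A ∧ (I ∧ false)
    ≡⟨ cong (A ∧_) (∧-zeroʳ I) ⟩
  A ∧ false
    ≡⟨ ∧-zeroʳ A ⟩
  false ∎
  where
  A I II : Bool
  A = isPartitionOf n π
  I = condI m 1 π
  II = condII m 1 π

validAt-forbidden : ∀ m b i j n p t k → p % 3 ≡ k → forbiddenResidue m k ≡ true →
  validAt m b i j n (p ∷ t) ≡ false
validAt-forbidden m b i j n p t k refl forbidden =
  trans (cong (λ z → isPartitionOf n (p ∷ t) ∧ ((not z ∧ condI m 2 t) ∧ rest)) forbidden)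
        (∧-zeroʳ (isPartitionOf n (p ∷ t)))
  where
  rest : Bool
  rest = condII m 1 (p ∷ t) ∧ largestAtMost b (p ∷ t)
         ∧ (countRes 2 (p ∷ t) ≡ᵇ i) ∧ (countRes 1 (p ∷ t) ≡ᵇ j)

-- Raising the bound on the largest part by one

headed : ℕ → ℕ → ℕ → ℕ → ℕ → ℕ
headed m s i j n = largest (validAt m s i j n) n s

-- Raising the bound from b to b + 1 adds the valid partitions with largest
-- part b + 1: the two validity predicates differ only on such partitions.
Pb-raise : ∀ m b i j n →
  Pb m (suc b) i j n ≡ Pb m b i j n + (if suc b ≤ᵇ n then headed m (suc b) i j n else 0)
Pb-raise m b i j n = count-head-change (validAt m b i j n) (validAt m (suc b) i j n) b n refl
  (λ x x≢b t → validAt-bound m b (suc b) i j n (suc x) t (≤ᵇ-suc-off-boundary x b x≢b))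
  (λ t → validAt-rejects m b i j n (suc b ∷ t)
           (cong (λ z → z ∧ (countRes 2 (suc b ∷ t) ≡ᵇ i) ∧ (countRes 1 (suc b ∷ t) ≡ᵇ j))
                 (dec-false (suc b ≤? b) 1+n≰n)))

Pb-raise-empty : ∀ m b i j n → headed m (suc b) i j n ≡ 0 → Pb m (suc b) i j n ≡ Pb m b i j n
Pb-raise-empty m b i j n none = begin
  Pb m (suc b) i j n
    ≡⟨ Pb-raise m b i j n ⟩
  Pb m b i j n + (if suc b ≤ᵇ n then headed m (suc b) i j n else 0)
    ≡⟨ cong (λ h → Pb m b i j n + (if suc b ≤ᵇ n then h else 0)) none ⟩
  Pb m b i j n + (if suc b ≤ᵇ n then 0 else 0)
    ≡⟨ cong (Pb m b i j n +_) (if-same (suc b ≤ᵇ n)) ⟩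
  Pb m b i j n + 0
    ≡⟨ +-identityʳ _ ⟩
  Pb m b i j n ∎
  where
  if-same : ∀ c → (if c then 0 else 0) ≡ 0
  if-same true  = refl
  if-same false = refl

headed-forbidden : ∀ m s k i j n → s % 3 ≡ k → forbiddenResidue m k ≡ true → headed m s i j n ≡ 0
headed-forbidden m s k i j n res forbidden = count-none _ (bounded s (n ∸ s))
  (λ t → validAt-forbidden m s i j n s t k res forbidden)

-- Removing the largest part

-- Deleting the first part shifts all indices by one, which exchanges the
-- conditions for m = 1 and m = 2.
data Dual : ℕ → ℕ → Set where
  one-two : Dual 1 2
  two-one : Dual 2 1

forbRes-shift : ∀ {m m'} → Dual m m' → ∀ k → forbRes m (suc k % 2) % 3 ≡ forbRes m' (k % 2) % 3
forbRes-shift one-two zero          = refl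
forbRes-shift one-two (suc zero)    = refl
forbRes-shift one-two (suc (suc k)) = forbRes-shift one-two k
forbRes-shift two-one zero          = refl
forbRes-shift two-one (suc zero)    = refl
forbRes-shift two-one (suc (suc k)) = forbRes-shift two-one k

gap-shift : ∀ {m m'} → Dual m m' → ∀ k → gap m (suc k % 2) ≡ gap m' (k % 2)
gap-shift one-two zero          = refl
gap-shift one-two (suc zero)    = refl
gap-shift one-two (suc (suc k)) = gap-shift one-two k
gap-shift two-one zero          = refl
gap-shift two-one (suc zero)    = refl
gap-shift two-one (suc (suc k)) = gap-shift two-one k

condI-shift : ∀ {m m'} → Dual m m' → ∀ k t → condI m (suc k) t ≡ condI m' k t
condI-shift d k []      = refl
condI-shift d k (a ∷ t) =
  cong₂ _∧_ (cong (λ z → not (a % 3 ≡ᵇ z)) (forbRes-shift d k)) (condI-shift d (suc k) t)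

condII-shift : ∀ {m m'} → Dual m m' → ∀ k t → condII m (suc k) t ≡ condII m' k t
condII-shift d k []          = refl
condII-shift d k (a ∷ [])    = refl
condII-shift d k (a ∷ b ∷ t) =
  cong₂ _∧_ (cong (λ z → b + z <ᵇ a) (gap-shift d k)) (condII-shift d (suc k) (b ∷ t))

hits : ℕ → ℕ → ℕ
hits k c = if k ≡ᵇ c then 1 else 0

countRes-cons : ∀ c s t k → s % 3 ≡ k → countRes c (s ∷ t) ≡ hits k c + countRes c t
countRes-cons c s t .(s % 3) refl with s % 3 ≡ᵇ c
... | true  = refl
... | false = refl

-- Boolean rearrangements matching validAt of s ∷ t against validAt of t,
-- for t empty and non-empty.  The conjunct y of the second is the gap
-- condition, which implies the ordering condition x of the first.
rearrange-[] : ∀ {E E' F B C C'} → E ≡ E' → F ≡ false → B ≡ true → C ≡ C' →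
  (true ∧ E) ∧ ((not F ∧ true) ∧ (true ∧ (B ∧ C))) ≡ E' ∧ C'
rearrange-[] refl refl refl refl = refl

rearrange-∷ : ∀ x NI {E E' F I I' y y' II II' B C C'} →
  E ≡ E' → F ≡ false → I ≡ I' → y ≡ y' → II ≡ II' → B ≡ true → C ≡ C' → (y' ≡ true → x ≡ true) →
  ((x ∧ NI) ∧ E) ∧ ((not F ∧ I) ∧ ((y ∧ II) ∧ (B ∧ C))) ≡ (NI ∧ E') ∧ (I' ∧ (II' ∧ (y' ∧ C')))
rearrange-∷ x NI {y = true} refl refl refl refl refl refl refl y⇒x
  rewrite y⇒x refl = refl
rearrange-∷ x NI {E} {I = I} {y = false} {II = II} refl refl refl refl refl refl refl _
  rewrite ∧-zeroʳ II | ∧-zeroʳ I | ∧-zeroʳ ((x ∧ NI) ∧ E) | ∧-zeroʳ (NI ∧ E) = refl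

validAt-tail : ∀ {m m'} → Dual m m' → ∀ s b₂ k i j n → s % 3 ≡ k → forbiddenResidue m k ≡ false →
  suc (gap m 1 + b₂) ≡ s → s ≤ n → ∀ t →
  validAt m s (hits k 2 + i) (hits k 1 + j) n (s ∷ t) ≡ validAt m' b₂ i j (n ∸ s) t
validAt-tail {m} {m'} d s b₂ k i j n res allowed refl s≤n = by-tail
  where
  first-allowed : (s % 3 ≡ᵇ forbRes m 1 % 3) ≡ false
  first-allowed = trans (cong (forbiddenResidue m) res) allowed
  s≤ᵇs : (s ≤ᵇ s) ≡ true
  s≤ᵇs = dec-true (s ≤? s) ≤-refl
  count-condition : ∀ c x t → (countRes c (s ∷ t) ≡ᵇ hits k c + x) ≡ (countRes c t ≡ᵇ x)
  count-condition c x t =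
    trans (cong (_≡ᵇ hits k c + x) (countRes-cons c s t k res)) (≡ᵇ-cancelˡ (hits k c) _ x)
  counts : ∀ t → ((countRes 2 (s ∷ t) ≡ᵇ hits k 2 + i) ∧ (countRes 1 (s ∷ t) ≡ᵇ hits k 1 + j))
                 ≡ ((countRes 2 t ≡ᵇ i) ∧ (countRes 1 t ≡ᵇ j))
  counts t = cong₂ _∧_ (count-condition 2 i t) (count-condition 1 j t)
  gap⇒ordered : ∀ b → (b ≤ᵇ b₂) ≡ true → (b ≤ᵇ s) ≡ true
  gap⇒ordered b e = dec-true (b ≤? s) (≤-trans (≤ᵇ-sound e) (m≤n⇒m≤1+n (m≤n+m b₂ (gap m 1))))
  by-tail : ∀ t → validAt m s (hits k 2 + i) (hits k 1 + j) n (s ∷ t) ≡ validAt m' b₂ i j (n ∸ s) t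
  by-tail []      = rearrange-[] (sum-condition s n 0 s≤n) first-allowed s≤ᵇs (counts [])
  by-tail (b ∷ t) = rearrange-∷ (b ≤ᵇ s) (nonIncPos (b ∷ t))
    (sum-condition s n (sum (b ∷ t)) s≤n) first-allowed (condI-shift d 1 (b ∷ t))
    (gap-condition b (gap m 1) b₂) (condII-shift d 1 (b ∷ t)) s≤ᵇs (counts (b ∷ t)) (gap⇒ordered b)

headed-tail : ∀ {m m'} → Dual m m' → ∀ s b₂ k i j n → s % 3 ≡ k → forbiddenResidue m k ≡ false →
  suc (gap m 1 + b₂) ≡ s → s ≤ n →
  headed m s (hits k 2 + i) (hits k 1 + j) n ≡ Pb m' b₂ i j (n ∸ s)
headed-tail {m} {m'} d s b₂ k i j n res allowed gap-eq s≤n =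
  trans (count-cong _ _ (bounded s (n ∸ s)) (validAt-tail d s b₂ k i j n res allowed gap-eq s≤n))
        (count-bounded (validAt m' b₂ i j (n ∸ s)) s (n ∸ s) above-s)
  where
  b₂<s : b₂ < s
  b₂<s = subst (b₂ <_) gap-eq (s≤s (m≤n+m b₂ (gap m 1)))
  above-s : ∀ p t → s < p → validAt m' b₂ i j (n ∸ s) (p ∷ t) ≡ false
  above-s p t s<p = validAt-rejects m' b₂ i j (n ∸ s) (p ∷ t)
    (cong (λ z → z ∧ (countRes 2 (p ∷ t) ≡ᵇ i) ∧ (countRes 1 (p ∷ t) ≡ᵇ j))
          (dec-false (p ≤? b₂) (λ p≤b₂ → <-irrefl refl (≤-<-trans p≤b₂ (<-trans b₂<s s<p)))))

headed-excess₂ : ∀ m s j n → s % 3 ≡ 2 → headed m s 0 j n ≡ 0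
headed-excess₂ m s j n res = count-none _ (bounded s (n ∸ s)) λ t →
  validAt-rejects m s 0 j n (s ∷ t)
    (trans (cong (λ z → (s ≤ᵇ s) ∧ (z ≡ᵇ 0) ∧ (countRes 1 (s ∷ t) ≡ᵇ j)) (countRes-cons 2 s t 2 res))
           (∧-zeroʳ (s ≤ᵇ s)))

headed-excess₁ : ∀ m s i n → s % 3 ≡ 1 → headed m s i 0 n ≡ 0
headed-excess₁ m s i n res = count-none _ (bounded s (n ∸ s)) λ t →
  validAt-rejects m s i 0 n (s ∷ t)
    (trans (cong (λ z → (s ≤ᵇ s) ∧ (countRes 2 (s ∷ t) ≡ᵇ i) ∧ (z ≡ᵇ 0)) (countRes-cons 1 s t 1 res))
           (trans (cong ((s ≤ᵇ s) ∧_) (∧-zeroʳ (countRes 2 (s ∷ t) ≡ᵇ i))) (∧-zeroʳ (s ≤ᵇ s))))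

bound-even : ∀ m N → bound m (2 * N) ≡ 3 * N
bound-even m N = cong₂ (λ r h → if r ≡ᵇ 0 then 3 * h else 3 * h + 3 ∸ m) even-mod (even-div N)
  where
  even-mod : 2 * N % 2 ≡ 0
  even-mod = trans (%-congˡ (*-comm 2 N)) (m*n%n≡0 N 2)
  even-div : ∀ N → 2 * N / 2 ≡ N
  even-div N = trans (/-congˡ (*-comm 2 N)) (m*n/n≡m N 2)

bound-odd : ∀ m N → m ≤ 3 → bound m (2 * N + 1) ≡ (3 ∸ m) + 3 * N
bound-odd m N m≤3 = begin
  bound m (2 * N + 1)
    ≡⟨ cong₂ (λ r h → if r ≡ᵇ 0 then 3 * h else 3 * h + 3 ∸ m) odd-mod odd-div ⟩
  3 * N + 3 ∸ m
    ≡⟨ +-∸-assoc (3 * N) m≤3 ⟩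
  3 * N + (3 ∸ m)
    ≡⟨ +-comm (3 * N) (3 ∸ m) ⟩
  (3 ∸ m) + 3 * N ∎
  where
  odd-mod : (2 * N + 1) % 2 ≡ 1
  odd-mod = trans (%-congˡ (trans (+-comm (2 * N) 1) (cong (1 +_) (*-comm 2 N)))) ([m+kn]%n≡m%n 1 N 2)
  odd-div : (2 * N + 1) / 2 ≡ N
  odd-div = begin
    (2 * N + 1) / 2       ≡⟨ +-distrib-/-∣ˡ 1 (m∣m*n N) ⟩
    2 * N / 2 + 0         ≡⟨ +-identityʳ _ ⟩
    2 * N / 2             ≡⟨ /-congˡ (*-comm 2 N) ⟩
    N * 2 / 2             ≡⟨ m*n/n≡m N 2 ⟩
    N ∎

-- 3(N + 1) written as 3 + 3N, the form in which 3N + 3 reduces to a successor.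
three-suc : ∀ N → 3 * (N + 1) ≡ 3 + 3 * N
three-suc N = trans (*-distribˡ-+ 3 N 1) (+-comm (3 * N) 3)

bound-even-suc : ∀ m N → bound m (2 * N + 2) ≡ 3 + 3 * N
bound-even-suc m N =
  trans (cong (bound m) (sym (*-distribˡ-+ 2 N 1))) (trans (bound-even m (N + 1)) (three-suc N))

residue : ∀ k N → (k + 3 * N) % 3 ≡ k % 3
residue k N = trans (%-congˡ (cong (k +_) (*-comm 3 N))) ([m+kn]%n≡m%n k N 3)

as-shiftCoeff : ∀ {s n h} s' f → s ≡ s' → (s ≤ n → h ≡ f (n ∸ s)) →
  (if s ≤ᵇ n then h else 0) ≡ shiftCoeff s' f n
as-shiftCoeff {s} {n} s' f refl h≡ with s ≤ᵇ n in s≤ᵇn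
... | true  = h≡ (≤ᵇ-sound s≤ᵇn)
... | false = refl

-- For m = 1 the bound rises from 3N to 3N + 2; the part 3N + 1 is
-- forbidden, the part 3N + 2 has residue 2 and leaves the gap 1.
identity₁ : ∀ N i j n → P 1 (2 * N + 1) i j n
  ≡ P 1 (2 * N) i j n + χ (1 ≤ᵇ i) * shiftCoeff (3 * N + 2) (P 2 (2 * N) (i ∸ 1) j) n
identity₁ N zero j n = begin
  P 1 (2 * N + 1) 0 j n
    ≡⟨ P-as-Pb 1 (2 * N + 1) (2 + 3 * N) 0 j n (bound-odd 1 N (s≤s z≤n)) ⟩
  Pb 1 (2 + 3 * N) 0 j n
    ≡⟨ Pb-raise-empty 1 (1 + 3 * N) 0 j n (headed-excess₂ 1 (2 + 3 * N) j n (residue 2 N)) ⟩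
  Pb 1 (1 + 3 * N) 0 j n
    ≡⟨ Pb-raise-empty 1 (3 * N) 0 j n (headed-forbidden 1 (1 + 3 * N) 1 0 j n (residue 1 N) refl) ⟩
  Pb 1 (3 * N) 0 j n
    ≡⟨ sym (P-as-Pb 1 (2 * N) (3 * N) 0 j n (bound-even 1 N)) ⟩
  P 1 (2 * N) 0 j n
    ≡⟨ sym (+-identityʳ _) ⟩
  P 1 (2 * N) 0 j n + 0 ∎
identity₁ N (suc i) j n = begin
  P 1 (2 * N + 1) (suc i) j n
    ≡⟨ P-as-Pb 1 (2 * N + 1) (2 + 3 * N) (suc i) j n (bound-odd 1 N (s≤s z≤n)) ⟩
  Pb 1 (2 + 3 * N) (suc i) j n
    ≡⟨ Pb-raise 1 (1 + 3 * N) (suc i) j n ⟩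
  Pb 1 (1 + 3 * N) (suc i) j n + (if 2 + 3 * N ≤ᵇ n then headed 1 (2 + 3 * N) (suc i) j n else 0)
    ≡⟨ cong₂ _+_
         (Pb-raise-empty 1 (3 * N) (suc i) j n
           (headed-forbidden 1 (1 + 3 * N) 1 (suc i) j n (residue 1 N) refl))
         (as-shiftCoeff (3 * N + 2) (P 2 (2 * N) i j) (+-comm 2 (3 * N)) λ s≤n →
           trans (headed-tail one-two (2 + 3 * N) (3 * N) 2 i j n (residue 2 N) refl refl s≤n)
                 (sym (P-as-Pb 2 (2 * N) (3 * N) i j (n ∸ (2 + 3 * N)) (bound-even 2 N)))) ⟩
  Pb 1 (3 * N) (suc i) j n + shiftCoeff (3 * N + 2) (P 2 (2 * N) i j) n
    ≡⟨ cong₂ _+_ (sym (P-as-Pb 1 (2 * N) (3 * N) (suc i) j n (bound-even 1 N))) (sym (+-identityʳ _)) ⟩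
  P 1 (2 * N) (suc i) j n + χ (1 ≤ᵇ suc i) * shiftCoeff (3 * N + 2) (P 2 (2 * N) i j) n ∎

-- For m = 1 the bound rises from 3N + 2 to 3N + 3, of residue 0, leaving the gap 1.
identity₂ : ∀ N i j n → P 1 (2 * N + 2) i j n
  ≡ P 1 (2 * N + 1) i j n + shiftCoeff (3 * (N + 1)) (P 2 (2 * N + 1) i j) n
identity₂ N i j n = begin
  P 1 (2 * N + 2) i j n
    ≡⟨ P-as-Pb 1 (2 * N + 2) (3 + 3 * N) i j n (bound-even-suc 1 N) ⟩
  Pb 1 (3 + 3 * N) i j n
    ≡⟨ Pb-raise 1 (2 + 3 * N) i j n ⟩
  Pb 1 (2 + 3 * N) i j n + (if 3 + 3 * N ≤ᵇ n then headed 1 (3 + 3 * N) i j n else 0)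
    ≡⟨ cong₂ _+_
         (sym (P-as-Pb 1 (2 * N + 1) (2 + 3 * N) i j n (bound-odd 1 N (s≤s z≤n))))
         (as-shiftCoeff (3 * (N + 1)) (P 2 (2 * N + 1) i j) (sym (three-suc N)) λ s≤n →
           trans (headed-tail one-two (3 + 3 * N) (1 + 3 * N) 0 i j n (residue 0 N) refl refl s≤n)
                 (sym (P-as-Pb 2 (2 * N + 1) (1 + 3 * N) i j (n ∸ (3 + 3 * N)) (bound-odd 2 N (s≤s (s≤s z≤n)))))) ⟩
  P 1 (2 * N + 1) i j n + shiftCoeff (3 * (N + 1)) (P 2 (2 * N + 1) i j) n ∎

-- For m = 2 the bound rises from 3N to 3N + 1, of residue 1, leaving the gap 0.
identity₃ : ∀ N i j n → P 2 (2 * N + 1) i j n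
  ≡ P 2 (2 * N) i j n + χ (1 ≤ᵇ j) * shiftCoeff (3 * N + 1) (P 1 (2 * N) i (j ∸ 1)) n
identity₃ N i zero n = begin
  P 2 (2 * N + 1) i 0 n
    ≡⟨ P-as-Pb 2 (2 * N + 1) (1 + 3 * N) i 0 n (bound-odd 2 N (s≤s (s≤s z≤n))) ⟩
  Pb 2 (1 + 3 * N) i 0 n
    ≡⟨ Pb-raise-empty 2 (3 * N) i 0 n (headed-excess₁ 2 (1 + 3 * N) i n (residue 1 N)) ⟩
  Pb 2 (3 * N) i 0 n
    ≡⟨ sym (P-as-Pb 2 (2 * N) (3 * N) i 0 n (bound-even 2 N)) ⟩
  P 2 (2 * N) i 0 n
    ≡⟨ sym (+-identityʳ _) ⟩
  P 2 (2 * N) i 0 n + 0 ∎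
identity₃ N i (suc j) n = begin
  P 2 (2 * N + 1) i (suc j) n
    ≡⟨ P-as-Pb 2 (2 * N + 1) (1 + 3 * N) i (suc j) n (bound-odd 2 N (s≤s (s≤s z≤n))) ⟩
  Pb 2 (1 + 3 * N) i (suc j) n
    ≡⟨ Pb-raise 2 (3 * N) i (suc j) n ⟩
  Pb 2 (3 * N) i (suc j) n + (if 1 + 3 * N ≤ᵇ n then headed 2 (1 + 3 * N) i (suc j) n else 0)
    ≡⟨ cong₂ _+_
         (sym (P-as-Pb 2 (2 * N) (3 * N) i (suc j) n (bound-even 2 N)))
         (as-shiftCoeff (3 * N + 1) (P 1 (2 * N) i j) (+-comm 1 (3 * N)) λ s≤n →
           trans (headed-tail two-one (1 + 3 * N) (3 * N) 1 i j n (residue 1 N) refl refl s≤n)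
                 (sym (P-as-Pb 1 (2 * N) (3 * N) i j (n ∸ (1 + 3 * N)) (bound-even 1 N)))) ⟩
  P 2 (2 * N) i (suc j) n + shiftCoeff (3 * N + 1) (P 1 (2 * N) i j) n
    ≡⟨ cong (P 2 (2 * N) i (suc j) n +_) (sym (+-identityʳ _)) ⟩
  P 2 (2 * N) i (suc j) n + χ (1 ≤ᵇ suc j) * shiftCoeff (3 * N + 1) (P 1 (2 * N) i j) n ∎

-- For m = 2 the bound rises from 3N + 1 to 3N + 3; the part 3N + 2 is
-- forbidden, the part 3N + 3 has residue 0 and leaves the gap 0.
identity₄ : ∀ N i j n → P 2 (2 * N + 2) i j n
  ≡ P 2 (2 * N + 1) i j n + shiftCoeff (3 * (N + 1)) (P 1 (2 * N + 1) i j) n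
identity₄ N i j n = begin
  P 2 (2 * N + 2) i j n
    ≡⟨ P-as-Pb 2 (2 * N + 2) (3 + 3 * N) i j n (bound-even-suc 2 N) ⟩
  Pb 2 (3 + 3 * N) i j n
    ≡⟨ Pb-raise 2 (2 + 3 * N) i j n ⟩
  Pb 2 (2 + 3 * N) i j n + (if 3 + 3 * N ≤ᵇ n then headed 2 (3 + 3 * N) i j n else 0)
    ≡⟨ cong₂ _+_
         (Pb-raise-empty 2 (1 + 3 * N) i j n (headed-forbidden 2 (2 + 3 * N) 2 i j n (residue 2 N) refl))
         (as-shiftCoeff (3 * (N + 1)) (P 1 (2 * N + 1) i j) (sym (three-suc N)) λ s≤n →
           trans (headed-tail two-one (3 + 3 * N) (2 + 3 * N) 0 i j n (residue 0 N) refl refl s≤n)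
                 (sym (P-as-Pb 1 (2 * N + 1) (2 + 3 * N) i j (n ∸ (3 + 3 * N)) (bound-odd 1 N (s≤s z≤n))))) ⟩
  Pb 2 (1 + 3 * N) i j n + shiftCoeff (3 * (N + 1)) (P 1 (2 * N + 1) i j) n
    ≡⟨ cong (_+ shiftCoeff (3 * (N + 1)) (P 1 (2 * N + 1) i j) n)
         (sym (P-as-Pb 2 (2 * N + 1) (1 + 3 * N) i j n (bound-odd 2 N (s≤s (s≤s z≤n))))) ⟩
  P 2 (2 * N + 1) i j n + shiftCoeff (3 * (N + 1)) (P 1 (2 * N + 1) i j) n ∎

lemma1 : (N i j : ℕ) → i ≤ N → j ≤ N → (n : ℕ) →
    (P 1 (2 * N + 1) i j n
       ≡ P 1 (2 * N) i j n
         + χ (1 ≤ᵇ i) * shiftCoeff (3 * N + 2) (P 2 (2 * N) (i ∸ 1) j) n)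
    × (P 1 (2 * N + 2) i j n
       ≡ P 1 (2 * N + 1) i j n + shiftCoeff (3 * (N + 1)) (P 2 (2 * N + 1) i j) n)
    × (P 2 (2 * N + 1) i j n
       ≡ P 2 (2 * N) i j n
         + χ (1 ≤ᵇ j) * shiftCoeff (3 * N + 1) (P 1 (2 * N) i (j ∸ 1)) n)
    × (P 2 (2 * N + 2) i j n
       ≡ P 2 (2 * N + 1) i j n + shiftCoeff (3 * (N + 1)) (P 1 (2 * N + 1) i j) n)
lemma1 N i j _ _ n = identity₁ N i j n , identity₂ N i j n , identity₃ N i j n , identity₄ N i j n
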